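{- For every condition $\varphi$, the rewriting system $\mathcal{R}^{\mathrm{cond}}(\varphi)$ is terminating, i.e. there is no infinite sequence of one-step rewrites $t_0\to t_1\to t_2\to\cdots$ in $\mathcal{R}^{\mathrm{cond}}(\varphi)$.
   Context: Setting. $\Sigma$ is an order-sorted algebraic signature containing sorts $\mathsf{Fact}$ and $\mathsf{Bool}$, and $\mathcal{D}$ is a $\Sigma$-algebra of facts presented by a set $A$ of equational attributes (associativity, commutativity, identity) together with directed equations that are confluent and terminating modulo $A$; $\mathcal{D}$ defines the Boolean connectives and a Boolean-valued equality $\_=\_$ on every sort, and every ground term of sort $\mathsf{Bool}$ reduces to $\mathit{true}$ or $\mathit{false}$. Terms are taken fully reduced and compared modulo $A$. A fact is a term of sort $\mathsf{Fact}$. Finite multisets of facts are built from facts with an associative, commutative union $\circ$ with identity $\emptyset$. Patterns. A pattern is an associative-commutative $\circ$-combination of blocks $[F]_!$, $[F]_?$, $[F]_0$ with $F$ a non-empty multiset of (possibly non-ground) facts, with $[F_1]_m\circ[F_2]_m=[F_1\circ F_2]_m$. For a pattern $P$, $P_!,P_?,P_0$ denote the multisets of facts in the blocks of the respective modality ($\emptyset$ if absent). A pattern is terminating-and-preserving if it has only $!$- and $?$-blocks and $P_?\neq\emptyset$. Conditions are generated by: $\mathsf{False}$; $\{B\}$ for a term $B$ of sort $\mathsf{Bool}$ (possibly with variables); $\neg\psi$; $\psi_1\vee\psi_2$; $\exists P.\psi$ with $P$ a terminating-and-preserving pattern. A subcondition of $\varphi$ is a subterm of $\varphi$ that is a condition.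 In $\exists P.\psi$ the quantifier binds in $\psi$ all variables of $P$ not already bound by the surrounding context. The rewriting system $\mathcal{R}^{\mathrm{cond}}(\varphi)$. States are terms $\{F,S\}^c$ with $F$ a ground multiset of facts and $S$ a finite stack (sequence of frames, top at the right), or terms $\mathsf{Sat}(B)$, $B\in\{\mathit{true},\mathit{false}\}$. Frames: $\mathsf{Res}(B)$; $\mathsf{Not}$; $[\vec a]^{\vec v}_\psi$; marked $[\vec a]^{\vec v,\downarrow}_\psi$; and, when $\psi=\exists P.\psi'$, iterator frames $[G\mid\vec a]^{\vec v}_\psi$ with $G$ a ground multiset of facts. Here $\psi$ is a subcondition of $\varphi$, $\vec v$ a list of distinct variables of $\varphi$ containing the free variables of $\psi$, $\vec a$ a list of ground values of the corresponding sorts, and $\sigma=\{\vec a/\vec v\}$. Rules ($S$ any stack; rules apply to whole states, matching modulo $A$ and $\mathcal{D}$'s equations): (1) $\{F,S[\vec a]^{\vec v}_{\mathsf{False}}\}^c\to\{F,S\,\mathsf{Res}(\mathit{false})\}^c$; $\{F,S[\vec a]^{\vec v}_{\{B\}}\}^c\to\{F,S\,\mathsf{Res}(\sigma(B))\}^c$. (2) $\{F,S[\vec a]^{\vec v}_{\neg\psi}\}^c\to\{F,S\,\mathsf{Not}\,[\vec a]^{\vec v}_{\psi}\}^c$; $\{F,S\,\mathsf{Not}\,\mathsf{Res}(B)\}^c\to\{F,S\,\mathsf{Res}(\neg B)\}^c$. (3) $\{F,S[\vec a]^{\vec v}_{\psi_1\vee\psi_2}\}^c\to\{F,S[\vec a]^{\vec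 v,\downarrow}_{\psi_1}[\vec a]^{\vec v}_{\psi_2}\}^c$; $\{F,S[\vec a]^{\vec v,\downarrow}_{\psi}\mathsf{Res}(\mathit{true})\}^c\to\{F,S\,\mathsf{Res}(\mathit{true})\}^c$; $\{F,S[\vec a]^{\vec v,\downarrow}_{\psi}\mathsf{Res}(\mathit{false})\}^c\to\{F,S[\vec a]^{\vec v}_{\psi}\}^c$. (4) $\{F,S[\vec a]^{\vec v}_{\exists P.\psi}\}^c\to\{F,S[F\mid\vec a]^{\vec v}_{\exists P.\psi}\}^c$. (5) Let $\vec w$ list the variables of $P$ not in $\vec v$. If $G=G'\circ\sigma'(P_!)\circ\sigma'(P_?)$ for some multiset $G'$ and $\sigma'=\{\vec a/\vec v,\vec b/\vec w\}$, then $\{F,S[G\mid\vec a]^{\vec v}_{\exists P.\psi}\}^c\to\{F,S[G'\circ\sigma'(P_!)\mid\vec a]^{\vec v}_{\exists P.\psi}[\vec a,\vec b]^{\vec v,\vec w}_{\psi}\}^c$. (6) $\{F,S[G\mid\vec a]^{\vec v}_{\exists P.\psi}\mathsf{Res}(\mathit{false})\}^c\to\{F,S[G\mid\vec a]^{\vec v}_{\exists P.\psi}\}^c$; $\{F,S[G\mid\vec a]^{\vec v}_{\exists P.\psi}\mathsf{Res}(\mathit{true})\}^c\to\{F,S\,\mathsf{Res}(\mathit{true})\}^c$. (7) If no $G',\vec b$ as in (5) exist, $\{F,S[G\mid\vec a]^{\vec v}_{\exists P.\psi}\}^c\to\{F,S\,\mathsf{Res}(\mathit{false})\}^c$. (8)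 $\{F,\mathsf{Res}(B)\}^c\to\mathsf{Sat}(B)$. -}

module Defs where

open import Data.Bool using (Bool)
open import Data.Empty using (⊥)
open import Data.Unit using (⊤)
open import Data.Product using (Σ; _×_; _,_)
open import Data.Sum using (_⊎_)
open import Data.Maybe using (Maybe; just; nothing)
import Data.Maybe as Maybe
open import Data.List using (List; []; _∷_; _++_)
open import Data.List.Membership.Propositional using (_∈_; _∉_)
open import Data.List.Relation.Unary.Any using (here; there)
open import Data.List.Relation.Unary.All using (All; []; _∷_)
open import Data.List.Relation.Unary.All.Properties using (++⁺)
open import Data.List.Relation.Unary.Unique.Propositional using (Unique)
open import Data.List.Relation.Binary.Permutation.Propositional using (_↭_)
open import Relation.Nullary using (¬_; yes; no)
open import Relation.Binary.Definitions using (DecidableEquality)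
open import Relation.Binary.PropositionalEquality using (_≡_; _≢_; refl)

-- Val s  : elements of D of sort s, i.e. ground fully reduced terms of
--          sort s, taken modulo the attributes A (canonical representatives,
--          so equality modulo A is _≡_).
-- Term s : terms of sort s possibly containing variables.
-- inst t ρ : the normal form of the ground instance of t under a ground
--          substitution ρ defined on the variables of t.

record DataAlgebra : Set₁ where
  field
    Sort    : Set
    factS   : Sort
    boolS   : Sort
    Val     : Sort → Set
    trueV   : Val boolS
    falseV  : Val boolS
    true≢false    : trueV ≢ falseV
    bool-canonical : (b : Val boolS) → (b ≡ trueV) ⊎ (b ≡ falseV)
    notV    : Val boolS → Val boolS
    notV-true  : notV trueV ≡ falseV
    notV-false : notV falseV ≡ trueV
    Var     : Set
    _≟_     : DecidableEquality Var
    sortOf  : Var → Sort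
    Term    : Sort → Set
    vars    : ∀ {s} → Term s → List Var
    inst    : ∀ {s} (t : Term s) → ((x : Var) → x ∈ vars t → Val (sortOf x)) → Val s

module Rewriting (D : DataAlgebra) where
  open DataAlgebra D

  V : Var → Set
  V x = Val (sortOf x)

  GFact : Set
  GFact = Val factS

  -- finite multisets of ground facts: lists, compared up to _↭_
  Multiset : Set
  Multiset = List GFact

  -- Patterns: only !- and ?-blocks, with non-empty ?-part
  -- (a terminating-and-preserving pattern, given by P_! and P_?).

  record Pattern : Set where
    constructor pat
    field
      bang : List (Term factS)
      ques : List (Term factS)
      ques-nonempty : ques ≢ []
  open Pattern public

  varsFs : List (Term factS) → List Var
  varsFs [] = []
  varsFs (t ∷ ts) = vars t ++ varsFs ts

  varsP : Pattern → List Var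
  varsP P = varsFs (bang P) ++ varsFs (ques P)

  data Cond : Set where
    False : Cond
    atom  : Term boolS → Cond
    ¬c_   : Cond → Cond
    _∨c_  : Cond → Cond → Cond
    ∃c    : Pattern → Cond → Cond

  data _⊑_ : Cond → Cond → Set where
    ⊑-refl : ∀ {ψ} → ψ ⊑ ψ
    ⊑-¬    : ∀ {ψ φ} → ψ ⊑ φ → ψ ⊑ (¬c φ)
    ⊑-∨ˡ   : ∀ {ψ φ₁ φ₂} → ψ ⊑ φ₁ → ψ ⊑ (φ₁ ∨c φ₂)
    ⊑-∨ʳ   : ∀ {ψ φ₁ φ₂} → ψ ⊑ φ₂ → ψ ⊑ (φ₁ ∨c φ₂)
    ⊑-∃    : ∀ {ψ P φ} → ψ ⊑ φ → ψ ⊑ ∃c P φ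

  varsC : Cond → List Var
  varsC False = []
  varsC (atom B) = vars B
  varsC (¬c ψ) = varsC ψ
  varsC (ψ₁ ∨c ψ₂) = varsC ψ₁ ++ varsC ψ₂
  varsC (∃c P ψ) = varsP P ++ varsC ψ

  data FreeIn (x : Var) : Cond → Set where
    fv-atom : ∀ {B} → x ∈ vars B → FreeIn x (atom B)
    fv-¬    : ∀ {ψ} → FreeIn x ψ → FreeIn x (¬c ψ)
    fv-∨ˡ   : ∀ {ψ₁ ψ₂} → FreeIn x ψ₁ → FreeIn x (ψ₁ ∨c ψ₂)
    fv-∨ʳ   : ∀ {ψ₁ ψ₂} → FreeIn x ψ₂ → FreeIn x (ψ₁ ∨c ψ₂)
    fv-∃    : ∀ {P ψ} → FreeIn x ψ → x ∉ varsP P → FreeIn x (∃c P ψ)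

  lookupA : ∀ {vs : List Var} → All V vs → (x : Var) → Maybe (V x)
  lookupA {[]} [] x = nothing
  lookupA {y ∷ vs} (a ∷ as) x with y ≟ x
  ... | yes refl = just a
  ... | no _ = lookupA as x

  envFor : (xs : List Var) → ((x : Var) → Maybe (V x)) →
           Maybe ((x : Var) → x ∈ xs → V x)
  envFor [] f = just (λ x ())
  envFor (y ∷ ys) f with f y | envFor ys f
  ... | just a | just g = just λ { x (here refl) → a ; x (there p) → g x p }
  ... | just _ | nothing = nothing
  ... | nothing | _ = nothing

  -- σ(t) for σ = {ā / v̄}; defined (just) iff σ covers the variables of t
  applyσ : ∀ {vs} → All V vs → ∀ {s} → Term s → Maybe (Val s)
  applyσ ā t = Maybe.map (inst t) (envFor (vars t) (lookupA ā))

  applyσs : ∀ {vs} → All V vs → List (Term factS) → Maybe Multiset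
  applyσs ā [] = just []
  applyσs ā (t ∷ ts) with applyσ ā t | applyσs ā ts
  ... | just g | just gs = just (g ∷ gs)
  ... | just _ | nothing = nothing
  ... | nothing | _ = nothing

  -- Frames, stacks and states.  Stacks are lists with the TOP AT THE HEAD:
  -- the paper's stack  S f₁ f₂  is written  f₂ ∷ f₁ ∷ S.

  data Frame : Set where
    Res    : Val boolS → Frame
    Not    : Frame
    call   : (vs : List Var) → All V vs → Cond → Frame
    marked : (vs : List Var) → All V vs → Cond → Frame
    iter   : Multiset → (vs : List Var) → All V vs →
             Pattern → Cond → Frame

  Stack : Set
  Stack = List Frame

  data State : Set where
    ⟨_,_⟩ : Multiset → Stack → State
    Sat   : Val boolS → State

  -- Well-formedness: the states of R^cond(φ)

  WFFrameData : Cond → (vs : List Var) → Cond → Set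
  WFFrameData φ vs ψ =
    ψ ⊑ φ × Unique vs × (∀ {x} → x ∈ vs → x ∈ varsC φ) ×
    (∀ {x} → FreeIn x ψ → x ∈ vs)

  WFFrame : Cond → Frame → Set
  WFFrame φ (Res b) = (b ≡ trueV) ⊎ (b ≡ falseV)
  WFFrame φ Not = ⊤
  WFFrame φ (call vs ā ψ) = WFFrameData φ vs ψ
  WFFrame φ (marked vs ā ψ) = WFFrameData φ vs ψ
  WFFrame φ (iter G vs ā P ψ) = WFFrameData φ vs (∃c P ψ)

  WFState : Cond → State → Set
  WFState φ ⟨ F , S ⟩ = All (WFFrame φ) S
  WFState φ (Sat b) = (b ≡ trueV) ⊎ (b ≡ falseV)

  ListsNew : (ws vs : List Var) → Pattern → Set
  ListsNew ws vs P =
    Unique ws ×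
    (∀ x → (x ∈ ws → (x ∈ varsP P × x ∉ vs)) × (x ∈ varsP P → x ∉ vs → x ∈ ws))

  infix 4 _⟶_
  data _⟶_ : State → State → Set where
    r1-False : ∀ {F S vs ā} →
      ⟨ F , call vs ā False ∷ S ⟩ ⟶ ⟨ F , Res falseV ∷ S ⟩
    r1-atom : ∀ {F S vs ā B b} → applyσ ā B ≡ just b →
      ⟨ F , call vs ā (atom B) ∷ S ⟩ ⟶ ⟨ F , Res b ∷ S ⟩
    r2-not : ∀ {F S vs ā ψ} →
      ⟨ F , call vs ā (¬c ψ) ∷ S ⟩ ⟶ ⟨ F , call vs ā ψ ∷ Not ∷ S ⟩
    r2-res : ∀ {F S B} →
      ⟨ F , Res B ∷ Not ∷ S ⟩ ⟶ ⟨ F , Res (notV B) ∷ S ⟩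
    r3-or : ∀ {F S vs ā ψ₁ ψ₂} →
      ⟨ F , call vs ā (ψ₁ ∨c ψ₂) ∷ S ⟩ ⟶ ⟨ F , call vs ā ψ₂ ∷ marked vs ā ψ₁ ∷ S ⟩
    r3-true : ∀ {F S vs ā ψ} →
      ⟨ F , Res trueV ∷ marked vs ā ψ ∷ S ⟩ ⟶ ⟨ F , Res trueV ∷ S ⟩
    r3-false : ∀ {F S vs ā ψ} →
      ⟨ F , Res falseV ∷ marked vs ā ψ ∷ S ⟩ ⟶ ⟨ F , call vs ā ψ ∷ S ⟩
    r4 : ∀ {F S vs ā P ψ} →
      ⟨ F , call vs ā (∃c P ψ) ∷ S ⟩ ⟶ ⟨ F , iter F vs ā P ψ ∷ S ⟩
    r5 : ∀ {F S G vs ā P ψ ws} (b̄ : All V ws) {G' Gb Gq} →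
      ListsNew ws vs P →
      applyσs (++⁺ ā b̄) (bang P) ≡ just Gb →
      applyσs (++⁺ ā b̄) (ques P) ≡ just Gq →
      G ↭ (G' ++ Gb ++ Gq) →
      ⟨ F , iter G vs ā P ψ ∷ S ⟩ ⟶
      ⟨ F , call (vs ++ ws) (++⁺ ā b̄) ψ ∷ iter (G' ++ Gb) vs ā P ψ ∷ S ⟩
    r6-false : ∀ {F S G vs ā P ψ} →
      ⟨ F , Res falseV ∷ iter G vs ā P ψ ∷ S ⟩ ⟶ ⟨ F , iter G vs ā P ψ ∷ S ⟩
    r6-true : ∀ {F S G vs ā P ψ} →
      ⟨ F , Res trueV ∷ iter G vs ā P ψ ∷ S ⟩ ⟶ ⟨ F , Res trueV ∷ S ⟩
    r7 : ∀ {F S G vs ā P ψ} ws →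
      ListsNew ws vs P →
      (∀ (b̄ : All V ws) G' Gb Gq →
         applyσs (++⁺ ā b̄) (bang P) ≡ just Gb →
         applyσs (++⁺ ā b̄) (ques P) ≡ just Gq →
         ¬ (G ↭ (G' ++ Gb ++ Gq))) →
      ⟨ F , iter G vs ā P ψ ∷ S ⟩ ⟶ ⟨ F , Res falseV ∷ S ⟩
    r8 : ∀ {F B} →
      ⟨ F , Res B ∷ [] ⟩ ⟶ Sat B

{-# OPTIONS --safe #-}
-- Termination via a measure in ℕ. No rule changes the facts F, so with n = |F| a call of ∃P.ψ can
-- prepay n body calls of ψ. Each use of rule (5) removes at least one fact from the iterator's
-- multiset, as P_? is non-empty, and this pays for the body call it pushes; every other rule
-- replaces the top frames of the stack by strictly lighter ones.
module Submission where

open import Defs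
open import Data.Nat using (ℕ; suc; _+_; _*_; _<_; _≤_; s≤s; z≤n)
open import Data.Nat.Properties
open import Data.Nat.Induction using (<-wellFounded)
open import Data.List using (List; []; _∷_; _++_; length)
open import Data.List.Properties using (length-++; ++-assoc)
open import Data.List.Relation.Binary.Permutation.Propositional using (_↭_)
open import Data.List.Relation.Binary.Permutation.Propositional.Properties using (↭-length)
open import Data.List.Relation.Unary.All using (All)
open import Data.List.Relation.Unary.All.Properties using (++⁺)
open import Data.Maybe using (just)
open import Data.Product using (_×_; _,_; ∃-syntax)
open import Function using (flip)
open import Induction.WellFounded using (WellFounded; module Subrelation)
open import Induction.InfiniteDescent using (InfiniteDescendingSequence; descent∧wf⇒empty)
open import Relation.Binary.Core using (Rel)
open import Relation.Binary.Construct.On as On using ()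
open import Relation.Nullary using (¬_; contradiction)
open import Relation.Binary.PropositionalEquality
  using (_≡_; _≢_; refl; sym; trans; cong; subst; module ≡-Reasoning)

wellFounded⇒¬infiniteDescendingSequence :
  ∀ {a r} {A : Set a} {_<_ : Rel A r} {f : ℕ → A} →
  WellFounded _<_ → ¬ InfiniteDescendingSequence _<_ f
wellFounded⇒¬infiniteDescendingSequence {_<_ = _<_} {f} wf desc =
  descent∧wf⇒empty descent wf (f 0) (0 , refl)
  where
  descent : ∀ {x} → ∃[ i ] f i ≡ x → ∃[ y ] (y < x) × (∃[ j ] f j ≡ y)
  descent (i , refl) = f (suc i) , desc i , suc i , refl

≢[]⇒0<length : ∀ {a} {A : Set a} {xs : List A} → xs ≢ [] → 0 < length xs
≢[]⇒0<length {xs = []}    xs≢[] = contradiction refl xs≢[]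
≢[]⇒0<length {xs = _ ∷ _} _     = s≤s z≤n

iteration-weight : ∀ c {m n} → m < n → suc (c + (2 + m * suc c)) ≤ 2 + n * suc c
iteration-weight c {m} {n} m<n = begin
  suc (c + (2 + m * suc c))   ≡⟨ cong suc (trans (+-suc c _) (cong suc (+-suc c _))) ⟩
  2 + suc (c + m * suc c)     ≤⟨ s≤s (s≤s (*-monoˡ-≤ (suc c) m<n)) ⟩
  2 + n * suc c               ∎
  where open ≤-Reasoning

module Termination (D : DataAlgebra) where
  open DataAlgebra D
  open Rewriting D

  length-applyσs : ∀ {vs} (ā : All V vs) ts {gs} →
                   applyσs ā ts ≡ just gs → length gs ≡ length ts
  length-applyσs ā [] refl = refl
  length-applyσs ā (t ∷ ts) eq with applyσ ā t | applyσs ā ts in eqs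
  ... | just g | just gs with refl ← eq = cong suc (length-applyσs ā ts eqs)

  length-remaining<length : ∀ {vs} (ā : All V vs) P G' Gb {G Gq} →
                            applyσs ā (ques P) ≡ just Gq → G ↭ G' ++ Gb ++ Gq →
                            length (G' ++ Gb) < length G
  length-remaining<length ā P G' Gb {G} {Gq} eq G↭ = begin-strict
    length (G' ++ Gb)               <⟨ m<m+n _ 0<|Gq| ⟩
    length (G' ++ Gb) + length Gq   ≡⟨ sym (length-++ (G' ++ Gb)) ⟩
    length ((G' ++ Gb) ++ Gq)       ≡⟨ cong length (++-assoc G' Gb Gq) ⟩
    length (G' ++ Gb ++ Gq)         ≡⟨ sym (↭-length G↭) ⟩
    length G                        ∎
    where
    open ≤-Reasoning
    0<|Gq| : 0 < length Gq
    0<|Gq| = subst (0 <_) (sym (length-applyσs ā (ques P) eq)) (≢[]⇒0<length (ques-nonempty P))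

  cost : ℕ → Cond → ℕ
  cost n False      = 2
  cost n (atom _)   = 2
  cost n (¬c ψ)     = 2 + cost n ψ
  cost n (ψ₁ ∨c ψ₂) = 2 + (cost n ψ₁ + cost n ψ₂)
  cost n (∃c P ψ)   = 3 + n * suc (cost n ψ)

  weight : ℕ → Frame → ℕ
  weight n (Res _)            = 1
  weight n Not                = 1
  weight n (call _ _ ψ)       = cost n ψ
  weight n (marked _ _ ψ)     = suc (cost n ψ)
  weight n (iter G _ _ _ ψ)   = 2 + length G * suc (cost n ψ)

  stackWeight : ℕ → Stack → ℕ
  stackWeight n []      = 0
  stackWeight n (f ∷ S) = weight n f + stackWeight n S

  measure : State → ℕ
  measure ⟨ F , S ⟩ = stackWeight (length F) S
  measure (Sat _)   = 0

  measure-decreases : ∀ {s s'} → s ⟶ s' → measure s' < measure s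
  measure-decreases r1-False    = ≤-refl
  measure-decreases (r1-atom _) = ≤-refl
  measure-decreases {⟨ F , call _ _ (¬c ψ) ∷ S ⟩} r2-not =
    ≤-reflexive (cong suc (+-suc (cost (length F) ψ) (stackWeight (length F) S)))
  measure-decreases r2-res      = ≤-refl
  measure-decreases {⟨ F , call _ _ (ψ₁ ∨c ψ₂) ∷ S ⟩} r3-or =
    ≤-reflexive (cong suc (begin
      c₂ + suc (c₁ + w)   ≡⟨ +-suc c₂ _ ⟩
      suc (c₂ + (c₁ + w)) ≡⟨ cong suc (sym (+-assoc c₂ c₁ w)) ⟩
      suc (c₂ + c₁ + w)   ≡⟨ cong (λ x → suc (x + w)) (+-comm c₂ c₁) ⟩
      suc (c₁ + c₂ + w)   ∎))
    where
    open ≡-Reasoning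
    c₁ c₂ w : ℕ
    c₁ = cost (length F) ψ₁
    c₂ = cost (length F) ψ₂
    w  = stackWeight (length F) S
  measure-decreases {⟨ F , _ ∷ marked _ _ ψ ∷ S ⟩} r3-true =
    s≤s (s≤s (m≤n+m (stackWeight (length F) S) (cost (length F) ψ)))
  measure-decreases r3-false    = n≤1+n _
  measure-decreases r4          = ≤-refl
  measure-decreases {⟨ F , iter G _ ā P ψ ∷ S ⟩} (r5 b̄ {G'} {Gb} _ _ eq G↭) = begin
    suc (c + (2 + m * suc c + w))   ≡⟨ cong suc (sym (+-assoc c _ w)) ⟩
    suc (c + (2 + m * suc c)) + w   ≤⟨ +-monoˡ-≤ w (iteration-weight c m<|G|) ⟩
    2 + length G * suc c + w        ∎
    where
    open ≤-Reasoning
    m<|G| : length (G' ++ Gb) < length G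
    m<|G| = length-remaining<length (++⁺ ā b̄) P G' Gb eq G↭
    c m w : ℕ
    c = cost (length F) ψ
    m = length (G' ++ Gb)
    w = stackWeight (length F) S
  measure-decreases r6-false    = ≤-refl
  measure-decreases {⟨ F , _ ∷ iter _ _ _ _ _ ∷ S ⟩} r6-true =
    s≤s (s≤s (m≤n+m (stackWeight (length F) S) _))
  measure-decreases {⟨ F , _ ∷ S ⟩} (r7 _ _ _) =
    s≤s (s≤s (m≤n+m (stackWeight (length F) S) _))
  measure-decreases r8          = s≤s z≤n

  ⟶-wellFounded : WellFounded (flip _⟶_)
  ⟶-wellFounded =
    Subrelation.wellFounded measure-decreases (On.wellFounded measure <-wellFounded)

theorem15 : (D : DataAlgebra) (φ : Rewriting.Cond D) (t : ℕ → Rewriting.State D) →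
            (∀ i → Rewriting.WFState D φ (t i)) →
            ¬ (∀ i → Rewriting._⟶_ D (t i) (t (suc i)))
theorem15 D φ t _ = wellFounded⇒¬infiniteDescendingSequence (Termination.⟶-wellFounded D)
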